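{- Let $G$ be a connected $p$-partite graph of order $n$, with partite sets of cardinalities $n_1,n_2,\dots,n_p$. If $\delta(G)\geq n_i$ for some $i$, then $\chi_d^t(G)\leq n-n'+1$, where $n'=\max\{n_i : \delta(G)\geq n_i\}$.
   Context: All graphs are finite, simple and undirected; $\delta(G)$ is the minimum degree. A $p$-partite graph is one whose vertex set is partitioned into $p$ independent sets (the partite sets). A total dominator coloring of a graph $G$ is a proper vertex coloring of $G$ in which each vertex of $G$ is adjacent to every vertex of some color class (a color class is the set of all vertices receiving a given color). The total dominator chromatic number $\chi_d^t(G)$ is the minimum number of color classes in a total dominator coloring of $G$. -}

module Defs where

open import Data.Nat using (ℕ; zero; suc; _+_; _∸_; _≤_; _⊔_; _⊓_; _≤?_)
open import Data.Fin using (Fin; zero; suc; _≟_)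
open import Data.Bool using (Bool; true; false; if_then_else_)
open import Data.Product using (Σ; ∃; _×_; _,_)
open import Relation.Binary.PropositionalEquality using (_≡_; _≢_)
open import Relation.Nullary.Decidable using (⌊_⌋)
open import Function using (_∘_)

record Graph (n : ℕ) : Set where
  field
    adj   : Fin n → Fin n → Bool
    sym   : ∀ u v → adj u v ≡ adj v u
    irrefl : ∀ v → adj v v ≡ false

open Graph public

Adj : ∀ {n} → Graph n → Fin n → Fin n → Set
Adj G u v = adj G u v ≡ true

count : ∀ {n} → (Fin n → Bool) → ℕ
count {zero}  f = 0
count {suc n} f = (if f zero then 1 else 0) + count (f ∘ suc)

maxF : ∀ {n} → (Fin n → ℕ) → ℕ
maxF {zero}  f = 0
maxF {suc n} f = f zero ⊔ maxF (f ∘ suc)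

minF : ∀ {n} → (Fin (suc n) → ℕ) → ℕ
minF {zero}  f = f zero
minF {suc n} f = f zero ⊓ minF (f ∘ suc)

degree : ∀ {n} → Graph n → Fin n → ℕ
degree G v = count (adj G v)

δ : ∀ {n} → Graph n → ℕ
δ {zero}  G = 0
δ {suc n} G = minF (degree G)

data Walk {n} (G : Graph n) : Fin n → Fin n → Set where
  here : ∀ {v} → Walk G v v
  step : ∀ {u v w} → Adj G u v → Walk G v w → Walk G u w

record Connected {n} (G : Graph n) : Set where
  field
    nonempty : Fin n
    walk     : ∀ u v → Walk G u v

-- p-partite structure: surjective assignment of vertices to p partite
-- sets (partite sets are nonempty blocks of a partition), each independent.
record Partite {n} (G : Graph n) (p : ℕ) : Set where
  field
    part        : Fin n → Fin p
    surjective  : ∀ i → ∃ λ v → part v ≡ i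
    independent : ∀ u v → part u ≡ part v → adj G u v ≡ false

open Partite public

partSize : ∀ {n p} {G : Graph n} → Partite G p → Fin p → ℕ
partSize P i = count (λ v → ⌊ part P v ≟ i ⌋)

-- n' = max { n_i : δ(G) ≥ n_i }  (terms with δ(G) < n_i contribute 0)
n′ : ∀ {n p} (G : Graph n) → Partite G p → ℕ
n′ G P = maxF (λ i → if ⌊ partSize P i ≤? δ G ⌋ then partSize P i else 0)

-- total dominator coloring with exactly k color classes:
-- proper coloring c onto Fin k (every color used, so k = number of
-- color classes) such that each vertex is adjacent to every vertex of
-- some color class.
record TotalDominatorColoring {n} (G : Graph n) (k : ℕ) (c : Fin n → Fin k) : Set where
  field
    proper     : ∀ u v → Adj G u v → c u ≢ c v
    onto       : ∀ j → ∃ λ v → c v ≡ j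
    dominating : ∀ v → ∃ λ j → ∀ u → c u ≡ j → Adj G v u

-- χ_d^t(G) ≤ m : some total dominator coloring has at most m color classes
-- (χ_d^t is the minimum number of classes, so this is exactly χ_d^t(G) ≤ m).
χdt≤ : ∀ {n} → Graph n → ℕ → Set
χdt≤ {n} G m = ∃ λ k → k ≤ m × Σ (Fin n → Fin k) (TotalDominatorColoring G k)

-- Take a partite set V_i with n_i ≤ δ(G) of the largest possible size n′.
-- Colour all of V_i with one colour and give every other vertex a colour of
-- its own: this is proper because V_i is independent, and uses
-- n − n′ + 1 colours.  It is total dominating because a vertex with a
-- neighbour u outside V_i dominates the singleton class {u}, while a vertex
-- whose neighbours all lie in V_i has at least δ(G) ≥ |V_i| of them, so its
-- neighbourhood is all of V_i.
module Submission where

open import Defs hiding (sym)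
open import Data.Nat using (ℕ; zero; suc; _+_; _∸_; _≤_; _≤?_; z≤n; s≤s)
open import Data.Nat.Properties
  using (≤-refl; ≤-reflexive; ≤-trans; ≤-pred; <-irrefl; m≤n⇒m≤1+n; m⊓n≤m; m⊓n≤n; m≤n⇒m⊔n≡n;
         m≥n⇒m⊔n≡m; ≤-total; +-comm; +-suc; m+n∸n≡m; ∸-monoʳ-≤; +-monoˡ-≤; module ≤-Reasoning)
open import Data.Fin using (Fin; zero; suc; _≟_; punchIn)
open import Data.Fin.Properties using (any?; punchIn-injective; punchInᵢ≢i)
open import Data.Bool using (Bool; true; false; if_then_else_)
import Data.Bool as Bool
open import Data.Product using (∃; _×_; _,_)
open import Data.Sum using (_⊎_; inj₁; inj₂)
open import Relation.Nullary using (Dec; yes; no; contradiction)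
open import Relation.Nullary.Decidable using (⌊_⌋; isYes≗does; dec-true; _×-dec_)
open import Relation.Binary.PropositionalEquality using (_≡_; _≢_; refl; sym; trans; cong; subst)
open import Function using (_∘_)

⌊⌋≡true⇒ : ∀ {a} {A : Set a} (a? : Dec A) → ⌊ a? ⌋ ≡ true → A
⌊⌋≡true⇒ (yes a) _ = a

_⊆ᵇ_ : ∀ {n} → (Fin n → Bool) → (Fin n → Bool) → Set
f ⊆ᵇ g = ∀ u → f u ≡ true → g u ≡ true

count-mono : ∀ {n} {f g : Fin n → Bool} → f ⊆ᵇ g → count f ≤ count g
count-mono {zero} f⊆g = z≤n
count-mono {suc n} {f} {g} f⊆g with f zero in f₀ | g zero in g₀
... | true  | true  = s≤s (count-mono (f⊆g ∘ suc))
... | true  | false = contradiction (trans (sym (f⊆g zero f₀)) g₀) λ ()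
... | false | true  = m≤n⇒m≤1+n (count-mono (f⊆g ∘ suc))
... | false | false = count-mono (f⊆g ∘ suc)

count-≤⇒⊇ : ∀ {n} {f g : Fin n → Bool} → f ⊆ᵇ g → count g ≤ count f → g ⊆ᵇ f
count-≤⇒⊇ {suc n} {f} {g} f⊆g g≤f u gu with f zero in f₀ | g zero in g₀ | u
... | true  | _     | zero  = f₀
... | true  | true  | suc u = count-≤⇒⊇ (f⊆g ∘ suc) (≤-pred g≤f) u gu
... | true  | false | _     = contradiction (trans (sym (f⊆g zero f₀)) g₀) λ ()
... | false | true  | _     = contradiction (≤-trans g≤f (count-mono (f⊆g ∘ suc))) (<-irrefl refl)
... | false | false | zero  = contradiction (trans (sym gu) g₀) λ ()
... | false | false | suc u = count-≤⇒⊇ (f⊆g ∘ suc) g≤f u gu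

record CollapseColoring {n} (f : Fin n → Bool) (k : ℕ) : Set where
  field
    colour            : Fin n → Fin (suc k)
    inside            : ∀ v → f v ≡ true → colour v ≡ zero
    outside           : ∀ v → f v ≡ false → colour v ≢ zero
    outside-injective : ∀ u v → f u ≡ false → f v ≡ false → colour u ≡ colour v → u ≡ v
    onto-suc          : ∀ j → ∃ λ v → colour v ≡ suc j

open CollapseColoring

collapse-cons-inside : ∀ {n k} {f : Fin (suc n) → Bool} → f zero ≡ true →
                       CollapseColoring (f ∘ suc) k → CollapseColoring f k
collapse-cons-inside {n} {k} {f} f₀ C = record
  { colour = c ; inside = in₀ ; outside = out₀ ; outside-injective = inj₀
  ; onto-suc = λ j → let v , cv = onto-suc C j in suc v , cv }
  where
  c : Fin (suc n) → Fin (suc k)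
  c zero    = zero
  c (suc v) = colour C v
  in₀ : ∀ v → f v ≡ true → c v ≡ zero
  in₀ zero    _ = refl
  in₀ (suc v) = inside C v
  out₀ : ∀ v → f v ≡ false → c v ≢ zero
  out₀ zero    f₀′ = contradiction (trans (sym f₀) f₀′) λ ()
  out₀ (suc v) = outside C v
  inj₀ : ∀ u v → f u ≡ false → f v ≡ false → c u ≡ c v → u ≡ v
  inj₀ zero    _       fu _  _  = contradiction (trans (sym f₀) fu) λ ()
  inj₀ (suc u) zero    _  fv _  = contradiction (trans (sym f₀) fv) λ ()
  inj₀ (suc u) (suc v) fu fv eq = cong suc (outside-injective C u v fu fv eq)

-- The new vertex takes colour 1; the old colours are shifted past it by punchIn 1.
collapse-cons-outside : ∀ {n k} {f : Fin (suc n) → Bool} → f zero ≡ false →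
                        CollapseColoring (f ∘ suc) k → CollapseColoring f (suc k)
collapse-cons-outside {n} {k} {f} f₀ C = record
  { colour = c ; inside = in₀ ; outside = out₀ ; outside-injective = inj₀ ; onto-suc = onto₀ }
  where
  shift : Fin (suc k) → Fin (suc (suc k))
  shift = punchIn (suc zero)
  c : Fin (suc n) → Fin (suc (suc k))
  c zero    = suc zero
  c (suc v) = shift (colour C v)
  in₀ : ∀ v → f v ≡ true → c v ≡ zero
  in₀ zero    f₀′ = contradiction (trans (sym f₀′) f₀) λ ()
  in₀ (suc v) fv  = cong shift (inside C v fv)
  out₀ : ∀ v → f v ≡ false → c v ≢ zero
  out₀ zero    _  ()
  out₀ (suc v) fv with colour C v in cv
  ... | zero  = λ _ → outside C v fv cv
  ... | suc _ = λ ()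
  inj₀ : ∀ u v → f u ≡ false → f v ≡ false → c u ≡ c v → u ≡ v
  inj₀ zero    zero    _  _  _  = refl
  inj₀ zero    (suc v) _  _  eq = contradiction (sym eq) (punchInᵢ≢i (suc zero) (colour C v))
  inj₀ (suc u) zero    _  _  eq = contradiction eq (punchInᵢ≢i (suc zero) (colour C u))
  inj₀ (suc u) (suc v) fu fv eq =
    cong suc (outside-injective C u v fu fv (punchIn-injective (suc zero) _ _ eq))
  onto₀ : ∀ j → ∃ λ v → c v ≡ suc j
  onto₀ zero    = zero , refl
  onto₀ (suc j) = let v , cv = onto-suc C j in suc v , cong shift cv

collapseColoring : ∀ {n} (f : Fin n → Bool) → ∃ λ k → k + count f ≡ n × CollapseColoring f k
collapseColoring {zero} f = 0 , refl , record
  { colour = λ () ; inside = λ () ; outside = λ () ; outside-injective = λ () ; onto-suc = λ () }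
collapseColoring {suc n} f with collapseColoring (f ∘ suc) | f zero in f₀
... | k , k+c≡n , C | true  = k , trans (+-suc k _) (cong suc k+c≡n) , collapse-cons-inside f₀ C
... | k , k+c≡n , C | false = suc k , cong suc k+c≡n , collapse-cons-outside f₀ C

module _ {n k} {f : Fin n → Bool} (C : CollapseColoring f k) where

  colour-zero⇒inside : ∀ v → colour C v ≡ zero → f v ≡ true
  colour-zero⇒inside v cv with f v in fv
  ... | true  = refl
  ... | false = contradiction cv (outside C v fv)

  colour-class-outside : ∀ u w → f u ≡ false → colour C w ≡ colour C u → w ≡ u
  colour-class-outside u w fu cw with f w in fw
  ... | true  = contradiction (trans (sym cw) (inside C w fw)) (outside C u fu)
  ... | false = outside-injective C w u fw fu cw

minF≤ : ∀ {m} (g : Fin (suc m) → ℕ) j → minF g ≤ g j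
minF≤ {zero}  g zero    = ≤-refl
minF≤ {suc m} g zero    = m⊓n≤m _ _
minF≤ {suc m} g (suc j) = ≤-trans (m⊓n≤n _ _) (minF≤ (g ∘ suc) j)

δ≤degree : ∀ {n} (G : Graph n) v → δ G ≤ degree G v
δ≤degree {suc n} G = minF≤ (degree G)

neighbour-outside-or-⊆ : ∀ {n} (G : Graph n) (f : Fin n → Bool) v → count f ≤ degree G v →
                         (∃ λ u → Adj G v u × f u ≡ false) ⊎ f ⊆ᵇ adj G v
neighbour-outside-or-⊆ G f v f≤deg
  with any? (λ u → (adj G v u Bool.≟ true) ×-dec (f u Bool.≟ false))
... | yes nbr = inj₁ nbr
... | no ¬nbr = inj₂ (count-≤⇒⊇ neighbours⊆f f≤deg)
  where
  neighbours⊆f : adj G v ⊆ᵇ f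
  neighbours⊆f u a with f u in fu
  ... | true  = refl
  ... | false = contradiction (u , a , fu) ¬nbr

collapse-totalDominator : ∀ {n k} (G : Graph n) {f : Fin n → Bool} →
                          (∀ u v → f u ≡ true → f v ≡ true → adj G u v ≡ false) →
                          (∃ λ v → f v ≡ true) → (∀ v → count f ≤ degree G v) →
                          (C : CollapseColoring f k) → TotalDominatorColoring G (suc k) (colour C)
collapse-totalDominator G {f} independent (v₀ , fv₀) f≤deg C = record
  { proper = proper ; onto = onto ; dominating = dominating }
  where
  proper : ∀ u v → Adj G u v → colour C u ≢ colour C v
  proper u v a eq with f u in fu | f v in fv
  ... | true  | true  = contradiction (trans (sym a) (independent u v fu fv)) λ ()
  ... | true  | false = outside C v fv (trans (sym eq) (inside C u fu))
  ... | false | true  = outside C u fu (trans eq (inside C v fv))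
  ... | false | false with refl ← outside-injective C u v fu fv eq =
    contradiction (trans (sym a) (irrefl G u)) λ ()
  onto : ∀ j → ∃ λ v → colour C v ≡ j
  onto zero    = v₀ , inside C v₀ fv₀
  onto (suc j) = onto-suc C j
  dominating : ∀ v → ∃ λ j → ∀ u → colour C u ≡ j → Adj G v u
  dominating v with neighbour-outside-or-⊆ G f v (f≤deg v)
  ... | inj₁ (u , a , fu) =
    colour C u , λ w cw → subst (Adj G v) (sym (colour-class-outside C u w fu cw)) a
  ... | inj₂ f⊆nbrs = zero , λ w cw → f⊆nbrs w (colour-zero⇒inside C w cw)

maxF-attained : ∀ {p} (g : Fin (suc p) → ℕ) → ∃ λ i → maxF g ≡ g i
maxF-attained {zero}  g = zero , m≥n⇒m⊔n≡m z≤n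
maxF-attained {suc p} g with ≤-total (g zero) (maxF (g ∘ suc))
... | inj₂ g₀≥ = zero , m≥n⇒m⊔n≡m g₀≥
... | inj₁ g₀≤ = let i , max≡ = maxF-attained (g ∘ suc) in suc i , trans (m≤n⇒m⊔n≡n g₀≤) max≡

n′-attained : ∀ {n p} (G : Graph n) (P : Partite G p) → (∃ λ i → partSize P i ≤ δ G) →
              ∃ λ i → partSize P i ≤ δ G × n′ G P ≤ partSize P i
n′-attained {p = suc p} G P (i₀ , small₀)
  with maxF-attained (λ i → if ⌊ partSize P i ≤? δ G ⌋ then partSize P i else 0)
... | i , max≡ with partSize P i ≤? δ G
...   | yes small = i , small , ≤-reflexive max≡
...   | no  _     = i₀ , small₀ , ≤-trans (≤-reflexive max≡) z≤n

suc≤∸+1 : ∀ {k c n m} → k + c ≡ n → m ≤ c → suc k ≤ n ∸ m + 1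
suc≤∸+1 {k} {c} {m = m} refl m≤c = begin
  suc k          ≡⟨ +-comm 1 k ⟩
  k + 1          ≡⟨ cong (_+ 1) (sym (m+n∸n≡m k c)) ⟩
  k + c ∸ c + 1  ≤⟨ +-monoˡ-≤ 1 (∸-monoʳ-≤ (k + c) m≤c) ⟩
  k + c ∸ m + 1  ∎
  where open ≤-Reasoning

theorem3p8 : ∀ {n p} (G : Graph n) (P : Partite G p) → Connected G →
               (∃ λ (i : Fin p) → partSize P i ≤ δ G) →
               χdt≤ G (n ∸ n′ G P + 1)
theorem3p8 G P _ small with n′-attained G P small
... | i , nᵢ≤δ , n′≤nᵢ with collapseColoring (λ v → ⌊ part P v ≟ i ⌋)
...   | k , k+nᵢ≡n , C =
  suc k , suc≤∸+1 k+nᵢ≡n n′≤nᵢ , colour C ,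
  collapse-totalDominator G independentᵢ nonemptyᵢ (λ v → ≤-trans nᵢ≤δ (δ≤degree G v)) C
  where
  independentᵢ : ∀ u v → ⌊ part P u ≟ i ⌋ ≡ true → ⌊ part P v ≟ i ⌋ ≡ true → adj G u v ≡ false
  independentᵢ u v u∈ v∈ = independent P u v (trans (⌊⌋≡true⇒ _ u∈) (sym (⌊⌋≡true⇒ _ v∈)))
  nonemptyᵢ : ∃ λ v → ⌊ part P v ≟ i ⌋ ≡ true
  nonemptyᵢ = let v , v∈ = surjective P i in
              v , trans (isYes≗does (part P v ≟ i)) (dec-true (part P v ≟ i) v∈)
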